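{- For a graph $G$, the supremum of the diameters of the connected components of $G$ is infinite if and only if $G$ contains pairwise disjoint finite vertex sets $V_0,V_1,\dots$ such that each $G_{\restriction V_k}$ is a path which is an isometric subgraph of $G$, the lengths of these paths are unbounded, and there are no edges of $G$ between distinct $V_k$ (so $G_{\restriction\bigcup_k V_k}$ is their direct sum).
   Context: $d_G(x,y)$ is the length of a shortest path between $x$ and $y$ in $G$ ($+\infty$ if none). The diameter of a connected component $C$ is $\sup\{d_G(x,y):x,y\in C\}$. An induced subgraph $G'$ of $G$ on $A$ is isometric if $d_{G'}(x,y)=d_G(x,y)$ for all $x,y\in A$. $G_{\restriction A}$ is the subgraph induced on $A$. A path's length is its number of vertices minus one. -}

module Defs where

open import Data.Nat using (ℕ; zero; suc; _≤_)
open import Data.Fin using (Fin; toℕ)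
open import Data.Product using (Σ; _×_; _,_; proj₁; proj₂)
open import Data.Sum using (_⊎_)
open import Data.Empty using (⊥)
open import Relation.Nullary using (¬_)
open import Relation.Binary.PropositionalEquality using (_≡_; _≢_)
open import Function.Bundles using (_↔_; _⇔_; Inverse)

record Graph : Set₁ where
  field
    V    : Set
    _~_  : V → V → Set
    sym  : ∀ {x y} → x ~ y → y ~ x
    irr  : ∀ {x} → ¬ (x ~ x)
open Graph public

data Walk (G : Graph) : V G → V G → ℕ → Set where
  [] : ∀ {x} → Walk G x x zero
  _∷_ : ∀ {x y z n} → _~_ G x y → Walk G y z n → Walk G x z (suc n)

-- d_G(x,y) ≤ n  (shortest walk length = shortest path length); d = ∞ iff never.
Dist≤ : (G : Graph) → V G → V G → ℕ → Set
Dist≤ G x y n = Σ ℕ λ k → k ≤ n × Walk G x y k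

Connected : (G : Graph) → V G → V G → Set
Connected G x y = Σ ℕ λ n → Dist≤ G x y n

SupDiamInfinite : Graph → Set
SupDiamInfinite G =
  (n : ℕ) → Σ (V G) λ x → Σ (V G) λ y →
    Connected G x y × ((m : ℕ) → Dist≤ G x y m → n ≤ m)

Induced : (G : Graph) → (V G → Set) → Graph
Induced G A = record
  { V   = Σ (V G) A
  ; _~_ = λ u v → _~_ G (proj₁ u) (proj₁ v)
  ; sym = sym G
  ; irr = irr G
  }

Isometric : (G : Graph) → (V G → Set) → Set
Isometric G A = (x y : Σ (V G) A) (n : ℕ) →
  Dist≤ (Induced G A) x y n ⇔ Dist≤ G (proj₁ x) (proj₁ y) n

-- The path graph P_m with m+1 vertices 0,…,m (length m).
PathAdj : ∀ {m} → Fin m → Fin m → Set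
PathAdj i j = suc (toℕ i) ≡ toℕ j ⊎ suc (toℕ j) ≡ toℕ i

IsPathOfLength : Graph → ℕ → Set
IsPathOfLength H m =
  Σ (Fin (suc m) ↔ V H) λ f →
    (i j : Fin (suc m)) → _~_ H (Inverse.to f i) (Inverse.to f j) ⇔ PathAdj i j

{-# OPTIONS --safe #-}
-- The vertex sequence of a shortest walk is a geodesic, and the trace of a geodesic is an
-- isometric path.  If some vertex v has infinite eccentricity, cut the k-th path out of a
-- shortest walk from v so that it lies between distances s_k and s_k + k from v, leaving gaps
-- of 2 between consecutive shells; then no two paths meet or are adjacent.  Otherwise every
-- eccentricity is finite, and the k-th path is taken as a prefix of a geodesic longer than twice
-- the eccentricities of all earlier start vertices: no earlier start vertex reaches both of its
-- ends, so the paths lie in distinct components.  Conversely, the ends of an isometric path of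
-- length m are at distance m in G.
module Submission where

open import Defs
open import Axiom.ExcludedMiddle using (ExcludedMiddle)
open import Axiom.DoubleNegationElimination using (em⇒dne)
open import Level using (0ℓ)
open import Data.Nat using (ℕ; zero; suc; _+_; _∸_; _≤_; _<_; _≤′_; ≤′-reflexive; ≤′-step; _≤?_; z≤n; s≤s)
open import Data.Nat.Properties
open import Data.Nat.Induction using (<-rec)
open import Data.Fin using (Fin; toℕ; fromℕ; fromℕ<)
open import Data.Fin.Properties using (toℕ-injective; toℕ-fromℕ<; toℕ≤pred[n])
open import Data.Product using (Σ; _×_; _,_; proj₁; proj₂)
open import Data.Sum using (_⊎_; inj₁; inj₂)
open import Data.Empty using (⊥; ⊥-elim)
open import Relation.Nullary using (¬_; yes; no)
open import Relation.Binary.Definitions using (tri<; tri≈; tri>)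
open import Relation.Binary.PropositionalEquality as ≡
  using (_≡_; _≢_; refl; trans; cong; subst; subst₂)
open import Function.Bundles using (_⇔_; Inverse; Equivalence; mk⇔; mk↔ₛ′)

monotone-by-steps : {f : ℕ → ℕ} → (∀ n → f n ≤ f (suc n)) → ∀ {m n} → m ≤ n → f m ≤ f n
monotone-by-steps {f} step m≤n = go (≤⇒≤′ m≤n)
  where
    go : ∀ {m n} → m ≤′ n → f m ≤ f n
    go (≤′-reflexive refl) = ≤-refl
    go (≤′-step m≤′n) = ≤-trans (go m≤′n) (step _)

Minimum : (ℕ → Set) → Set
Minimum P = Σ ℕ λ m → P m × (∀ {k} → P k → m ≤ k)

least : ExcludedMiddle 0ℓ → {P : ℕ → Set} {n : ℕ} → P n → Minimum P
least em {P} {n} = <-rec (λ n → P n → Minimum P) minimise n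
  where
    minimise : ∀ n → (∀ {m} → m < n → P m → Minimum P) → P n → Minimum P
    minimise n below pn with em {Σ ℕ λ k → k < n × P k}
    ... | yes (k , k<n , pk) = below k<n pk
    ... | no none = n , pn , λ {k} pk → ≮⇒≥ λ k<n → none (k , k<n , pk)

adjacent-indices : ∀ {i j} → j ≤ i + 1 → i ≤ j + 1 → i ≢ j → suc i ≡ j ⊎ suc j ≡ i
adjacent-indices {i} {j} j≤i+1 i≤j+1 i≢j with <-cmp i j
... | tri< i<j _ _ = inj₁ (≤-antisym i<j (subst (j ≤_) (+-comm i 1) j≤i+1))
... | tri≈ _ i≡j _ = ⊥-elim (i≢j i≡j)
... | tri> _ _ j<i = inj₂ (≤-antisym j<i (subst (i ≤_) (+-comm j 1) i≤j+1))

clamp : ∀ {L} → ℕ → Fin (suc L)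
clamp {L} t with t ≤? L
... | yes t≤L = fromℕ< (s≤s t≤L)
... | no _ = fromℕ L

toℕ-clamp : ∀ {L t} → t ≤ L → toℕ (clamp {L} t) ≡ t
toℕ-clamp {L} {t} t≤L with t ≤? L
... | yes _ = toℕ-fromℕ< _
... | no t≰L = ⊥-elim (t≰L t≤L)

clamp-toℕ : ∀ {L} (i : Fin (suc L)) → clamp (toℕ i) ≡ i
clamp-toℕ i = toℕ-injective (toℕ-clamp (toℕ≤pred[n] i))

module _ {K : Graph} where

  _∷ʳ_ : ∀ {x y z n} → Walk K x y n → _~_ K y z → Walk K x z (suc n)
  [] ∷ʳ e = e ∷ []
  (d ∷ w) ∷ʳ e = d ∷ (w ∷ʳ e)

  reverse : ∀ {x y n} → Walk K x y n → Walk K y x n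
  reverse [] = []
  reverse (e ∷ w) = reverse w ∷ʳ sym K e

  infixr 5 _++_
  _++_ : ∀ {x y z m n} → Walk K x y m → Walk K y z n → Walk K x z (m + n)
  [] ++ w = w
  (e ∷ v) ++ w = e ∷ (v ++ w)

  walk⇒connected : ∀ {x y n} → Walk K x y n → Connected K x y
  walk⇒connected {n = n} w = n , n , ≤-refl , w

  Dist≤-mono : ∀ {x y m n} → m ≤ n → Dist≤ K x y m → Dist≤ K x y n
  Dist≤-mono m≤n (k , k≤m , w) = k , ≤-trans k≤m m≤n , w

  Dist≤-sym : ∀ {x y n} → Dist≤ K x y n → Dist≤ K y x n
  Dist≤-sym (k , k≤n , w) = k , k≤n , reverse w

  -- w ! i is the vertex reached after i steps of w (the end vertex once i exceeds the length).
  _!_ : ∀ {x y n} → Walk K x y n → ℕ → V K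
  _!_ {x} [] _ = x
  _!_ {x} (_ ∷ _) zero = x
  (_ ∷ w) ! suc i = w ! i

  !-zero : ∀ {x y n} (w : Walk K x y n) → w ! 0 ≡ x
  !-zero [] = refl
  !-zero (_ ∷ _) = refl

  !-step : ∀ {x y n} (w : Walk K x y n) i → i < n → _~_ K (w ! i) (w ! suc i)
  !-step {x} (e ∷ w) zero _ = subst (_~_ K x) (≡.sym (!-zero w)) e
  !-step (_ ∷ w) (suc i) (s≤s i<n) = !-step w i i<n

  take : ∀ {x y n} (w : Walk K x y n) i → i ≤ n → Walk K x (w ! i) i
  take [] zero _ = []
  take (_ ∷ _) zero _ = []
  take (e ∷ w) (suc i) (s≤s i≤n) = e ∷ take w i i≤n

  drop : ∀ {x y n} (w : Walk K x y n) i → Walk K (w ! i) y (n ∸ i)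
  drop [] zero = []
  drop [] (suc _) = []
  drop (e ∷ w) zero = e ∷ w
  drop (_ ∷ w) (suc i) = drop w i

  walkAlong : (q : ℕ → V K) {L : ℕ} → (∀ t → t < L → _~_ K (q t) (q (suc t))) →
              ∀ {i j} → i ≤ j → j ≤ L → Walk K (q i) (q j) (j ∸ i)
  walkAlong q {L} step {i} {j} i≤j j≤L =
    subst (λ t → Walk K (q i) (q t) (j ∸ i)) (m∸n+n≡m i≤j)
      (ladder (j ∸ i) (≤-trans (≤-reflexive (m∸n+n≡m i≤j)) j≤L))
    where
      ladder : ∀ k → k + i ≤ L → Walk K (q i) (q (k + i)) k
      ladder zero _ = []
      ladder (suc k) k+i<L = ladder k (<⇒≤ k+i<L) ∷ʳ step (k + i) k+i<L

lift : ∀ {G : Graph} {A : V G → Set} {x y n} →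
       Walk (Induced G A) x y n → Walk G (proj₁ x) (proj₁ y) n
lift [] = []
lift (e ∷ w) = e ∷ lift w

record Geodesic (K : Graph) (p : ℕ → V K) (L : ℕ) : Set where
  field
    step  : ∀ i → i < L → _~_ K (p i) (p (suc i))
    tight : ∀ {i j k} → i ≤ L → j ≤ L → Walk K (p i) (p j) k → j ≤ i + k

segment : ∀ {K p L s M} → Geodesic K p L → s + M ≤ L → Geodesic K (λ i → p (s + i)) M
segment {K} {p} {L} {s} {M} g s+M≤L = record
  { step  = λ i i<M → subst (λ t → _~_ K (p (s + i)) (p t)) (≡.sym (+-suc s i))
                        (step (s + i) (≤-trans (+-monoʳ-< s i<M) s+M≤L))
  ; tight = λ {i} {j} {k} i≤M j≤M w → +-cancelˡ-≤ s j (i + k)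
              (subst (s + j ≤_) (+-assoc s i k) (tight (inside i≤M) (inside j≤M) w))
  }
  where
    open Geodesic g
    inside : ∀ {i} → i ≤ M → s + i ≤ L
    inside i≤M = ≤-trans (+-monoʳ-≤ s i≤M) s+M≤L

record ShortestWalk (K : Graph) (x y : V K) : Set where
  field
    length  : ℕ
    walk    : Walk K x y length
    minimal : ∀ {k} → Walk K x y k → length ≤ k
open ShortestWalk

shortestWalk : ExcludedMiddle 0ℓ → ∀ {K x y} → Connected K x y → ShortestWalk K x y
shortestWalk em (_ , _ , _ , w) with least em w
... | n , w′ , minimal = record { length = n ; walk = w′ ; minimal = minimal }

shortest⇒geodesic : ∀ {K x y} (w : ShortestWalk K x y) → Geodesic K (walk w !_) (length w)
shortest⇒geodesic w = record
  { step  = !-step (walk w)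
  ; tight = λ {i} {j} {k} i≤n j≤n v →
      detour-bound j≤n (minimal w ((take (walk w) i i≤n ++ v) ++ drop (walk w) j))
  }
  where
    detour-bound : ∀ {a j n} → j ≤ n → n ≤ a + (n ∸ j) → j ≤ a
    detour-bound {a} {j} {n} j≤n n≤a+[n∸j] = subst (_≤ a) (m∸[m∸n]≡n j≤n)
      (m≤n+o⇒m∸n≤o n (n ∸ j) (subst (n ≤_) (+-comm a (n ∸ j)) n≤a+[n∸j]))

shortest-position-bound : ∀ {K x y} (w : ShortestWalk K x y) {j m} →
  j ≤ length w → Walk K x (walk w ! j) m → j ≤ m
shortest-position-bound {K} w j≤n v =
  Geodesic.tight (shortest⇒geodesic w) z≤n j≤n
    (subst (λ z → Walk K z (walk w ! _) _) (≡.sym (!-zero (walk w))) v)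

Trace : (K : Graph) → (ℕ → V K) → ℕ → V K → Set
Trace K p L v = Σ (Fin (suc L)) λ i → p (toℕ i) ≡ v

module _ {G : Graph} {p : ℕ → V G} {L : ℕ} (g : Geodesic G p L) where
  open Geodesic g

  private
    H : Graph
    H = Induced G (Trace G p L)

    vertex : Fin (suc L) → V H
    vertex i = p (toℕ i) , i , refl

    index : V H → Fin (suc L)
    index (_ , i , _) = i

    bound : (i : Fin (suc L)) → toℕ i ≤ L
    bound = toℕ≤pred[n]

    successor-adjacent : (i j : Fin (suc L)) → suc (toℕ i) ≡ toℕ j → _~_ G (p (toℕ i)) (p (toℕ j))
    successor-adjacent i j 1+i≡j = subst (λ t → _~_ G (p (toℕ i)) (p t)) 1+i≡j
      (step (toℕ i) (subst (_≤ L) (≡.sym 1+i≡j) (bound j)))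

    adjacent⇒PathAdj : (i j : Fin (suc L)) → _~_ G (p (toℕ i)) (p (toℕ j)) → PathAdj i j
    adjacent⇒PathAdj i j e = adjacent-indices
      (tight (bound i) (bound j) (e ∷ []))
      (tight (bound j) (bound i) (sym G e ∷ []))
      (λ i≡j → irr G (subst (λ t → _~_ G (p (toℕ i)) (p t)) (≡.sym i≡j) e))

    PathAdj⇒adjacent : (i j : Fin (suc L)) → PathAdj i j → _~_ G (p (toℕ i)) (p (toℕ j))
    PathAdj⇒adjacent i j (inj₁ 1+i≡j) = successor-adjacent i j 1+i≡j
    PathAdj⇒adjacent i j (inj₂ 1+j≡i) = sym G (successor-adjacent j i 1+j≡i)

    along : ℕ → V H
    along t = vertex (clamp t)

    along-step : ∀ t → t < L → _~_ H (along t) (along (suc t))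
    along-step t t<L = subst₂ (λ a b → _~_ G (p a) (p b))
      (≡.sym (toℕ-clamp (<⇒≤ t<L))) (≡.sym (toℕ-clamp t<L)) (step t t<L)

    walkBetween : (i j : Fin (suc L)) → toℕ i ≤ toℕ j → Walk H (vertex i) (vertex j) (toℕ j ∸ toℕ i)
    walkBetween i j i≤j = subst₂ (λ a b → Walk H a b (toℕ j ∸ toℕ i))
      (cong vertex (clamp-toℕ i)) (cong vertex (clamp-toℕ j))
      (walkAlong {K = H} along along-step i≤j (bound j))

    shortcut : (i j : Fin (suc L)) {m : ℕ} → toℕ i ≤ toℕ j → Walk G (p (toℕ i)) (p (toℕ j)) m →
               Dist≤ H (vertex i) (vertex j) m
    shortcut i j i≤j w =
      _ , m≤n+o⇒m∸n≤o (toℕ j) (toℕ i) (tight (bound i) (bound j) w) , walkBetween i j i≤j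

  trace-isPath : IsPathOfLength (Induced G (Trace G p L)) L
  trace-isPath = mk↔ₛ′ vertex index (λ { (_ , _ , refl) → refl }) (λ _ → refl)
               , λ i j → mk⇔ (adjacent⇒PathAdj i j) (PathAdj⇒adjacent i j)

  trace-isometric : Isometric G (Trace G p L)
  trace-isometric (_ , i , refl) (_ , j , refl) n =
    mk⇔ (λ { (k , k≤n , w) → k , k≤n , lift w }) shorten
    where
      shorten : Dist≤ G (p (toℕ i)) (p (toℕ j)) n → Dist≤ H (vertex i) (vertex j) n
      shorten (m , m≤n , w) with toℕ i ≤? toℕ j
      ... | yes i≤j = Dist≤-mono m≤n (shortcut i j i≤j w)
      ... | no i≰j = Dist≤-mono m≤n (Dist≤-sym (shortcut j i (<⇒≤ (≰⇒> i≰j)) (reverse w)))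

path⇒geodesic : ∀ {H m} (P : IsPathOfLength H m) →
                Geodesic H (λ t → Inverse.to (proj₁ P) (clamp t)) m
path⇒geodesic {H} {m} (f , adjacency) = record
  { step  = λ t t<m → Equivalence.from (adjacency (clamp t) (clamp (suc t)))
              (inj₁ (trans (cong suc (toℕ-clamp (<⇒≤ t<m))) (≡.sym (toℕ-clamp t<m))))
  ; tight = λ {i} {j} {k} i≤m j≤m w →
      subst₂ _≤_ (index-clamp j≤m) (cong (_+ k) (index-clamp i≤m)) (index-lipschitz w)
  }
  where
    open Inverse f using (to; from; strictlyInverseˡ; strictlyInverseʳ)

    index-clamp : ∀ {t} → t ≤ m → toℕ (from (to (clamp t))) ≡ t
    index-clamp t≤m = trans (cong toℕ (strictlyInverseʳ _)) (toℕ-clamp t≤m)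

    index-step : ∀ {u v} → _~_ H u v → toℕ (from v) ≤ suc (toℕ (from u))
    index-step {u} {v} e with Equivalence.to (adjacency (from u) (from v))
      (subst₂ (_~_ H) (≡.sym (strictlyInverseˡ u)) (≡.sym (strictlyInverseˡ v)) e)
    ... | inj₁ 1+u≡v = ≤-reflexive (≡.sym 1+u≡v)
    ... | inj₂ 1+v≡u = m≤n⇒m≤1+n (≤-trans (n≤1+n _) (≤-reflexive 1+v≡u))

    index-lipschitz : ∀ {u v k} → Walk H u v k → toℕ (from v) ≤ toℕ (from u) + k
    index-lipschitz [] = m≤m+n _ 0
    index-lipschitz {u} {k = suc k} (e ∷ w) =
      ≤-trans (index-lipschitz w)
        (≤-trans (+-monoˡ-≤ k (index-step e)) (≤-reflexive (≡.sym (+-suc (toℕ (from u)) k))))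

FarFrom : (G : Graph) → V G → ℕ → V G → Set
FarFrom G v n x = Connected G v x × ((m : ℕ) → Dist≤ G v x m → n ≤ m)

geodesic-ends-far : ∀ {K p L} → Geodesic K p L → FarFrom K (p 0) L (p L)
geodesic-ends-far g =
  walk⇒connected (walkAlong _ (Geodesic.step g) z≤n ≤-refl) ,
  λ { m (k , k≤m , w) → ≤-trans (Geodesic.tight g z≤n ≤-refl w) k≤m }

isometric-far : ∀ {G A} → Isometric G A → ∀ {x n y} →
                FarFrom (Induced G A) x n y → FarFrom G (proj₁ x) n (proj₁ y)
isometric-far iso {x} {n} {y} ((m , k , k≤m , w) , far) =
  (m , k , k≤m , lift w) , λ j d → far j (Equivalence.from (iso x y j) d)

InfiniteEccentricity : (G : Graph) → V G → Set
InfiniteEccentricity G v = (n : ℕ) → Σ (V G) (FarFrom G v n)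

EccentricityBound : (G : Graph) → V G → ℕ → Set
EccentricityBound G v e = (x : V G) → Connected G v x → Dist≤ G v x e

finite-eccentricity : ExcludedMiddle 0ℓ → ∀ {G v} →
  ¬ InfiniteEccentricity G v → Σ ℕ (EccentricityBound G v)
finite-eccentricity em {G} {v} ¬infinite = n , within
  where
    dne = em⇒dne em

    nothing-far : Σ ℕ λ n → ¬ Σ (V G) (FarFrom G v n)
    nothing-far = dne λ none → ¬infinite λ n → dne λ nothing → none (n , nothing)

    n = proj₁ nothing-far

    within : EccentricityBound G v n
    within x c = dne λ beyond → proj₂ nothing-far
      (x , c , λ m d → ≮⇒≥ λ m<n → beyond (Dist≤-mono (<⇒≤ m<n) d))

SeparatedIsometricPaths : Graph → Set₁
SeparatedIsometricPaths G =
  Σ (ℕ → V G → Set) λ Vs → Σ (ℕ → ℕ) λ len →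
    ((k : ℕ) → IsPathOfLength (Induced G (Vs k)) (len k))
    × ((k : ℕ) → Isometric G (Vs k))
    × ((n : ℕ) → Σ ℕ λ k → n ≤ len k)
    × ((k l : ℕ) → k ≢ l → (v : V G) → Vs k v → Vs l v → ⊥)
    × ((k l : ℕ) → k ≢ l → (u v : V G) → Vs k u → Vs l v → ¬ (_~_ G u v))

separated-geodesics⇒paths : ∀ {G} (P : ℕ → ℕ → V G) (len : ℕ → ℕ) →
  (∀ k → Geodesic G (P k) (len k)) →
  (∀ n → Σ ℕ λ k → n ≤ len k) →
  (∀ {k l} → k < l → ∀ {a b} → a ≤ len k → b ≤ len l → ¬ Dist≤ G (P k a) (P l b) 1) →
  SeparatedIsometricPaths G
separated-geodesics⇒paths {G} P len geodesic unbounded apart =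
  (λ k → Trace G (P k) (len k)) , len ,
  (λ k → trace-isPath (geodesic k)) ,
  (λ k → trace-isometric (geodesic k)) ,
  unbounded ,
  (λ k l k≢l v u∈k v∈l → traces-apart k≢l u∈k v∈l (0 , z≤n , [])) ,
  (λ k l k≢l u v u∈k v∈l e → traces-apart k≢l u∈k v∈l (1 , ≤-refl , e ∷ []))
  where
    traces-apart : ∀ {k l} → k ≢ l → ∀ {u v} →
      Trace G (P k) (len k) u → Trace G (P l) (len l) v → ¬ Dist≤ G u v 1
    traces-apart {k} {l} k≢l (i , refl) (j , refl) d with <-cmp k l
    ... | tri< k<l _ _ = apart k<l (toℕ≤pred[n] i) (toℕ≤pred[n] j) d
    ... | tri≈ _ k≡l _ = k≢l k≡l
    ... | tri> _ _ l<k = apart l<k (toℕ≤pred[n] j) (toℕ≤pred[n] i) (Dist≤-sym d)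

infinite-eccentricity⇒paths : ExcludedMiddle 0ℓ → ∀ {G v} →
  InfiniteEccentricity G v → SeparatedIsometricPaths G
infinite-eccentricity⇒paths em {G} {v} infinite =
  separated-geodesics⇒paths P (λ k → k) geodesic (λ n → n , ≤-refl) apart
  where
    -- The k-th path sits at distances shell k, …, shell k + k from v.
    shell : ℕ → ℕ
    shell zero = 0
    shell (suc k) = suc (suc (shell k + k))

    shell-mono : ∀ {k l} → k ≤ l → shell k ≤ shell l
    shell-mono = monotone-by-steps λ n → ≤-trans (m≤m+n (shell n) n) (m≤n+m _ 2)

    ray : (k : ℕ) → ShortestWalk G v (proj₁ (infinite (shell k + k)))
    ray k = shortestWalk em (proj₁ (proj₂ (infinite (shell k + k))))

    long : ∀ k → shell k + k ≤ length (ray k)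
    long k = proj₂ (proj₂ (infinite (shell k + k))) _ (_ , ≤-refl , walk (ray k))

    P : ℕ → ℕ → V G
    P k i = walk (ray k) ! (shell k + i)

    geodesic : ∀ k → Geodesic G (P k) k
    geodesic k = segment (shortest⇒geodesic (ray k)) (long k)

    on-ray : ∀ {k a} → a ≤ k → shell k + a ≤ length (ray k)
    on-ray {k} a≤k = ≤-trans (+-monoʳ-≤ (shell k) a≤k) (long k)

    apart : ∀ {k l} → k < l → ∀ {a b} → a ≤ k → b ≤ l → ¬ Dist≤ G (P k a) (P l b) 1
    apart {k} {l} k<l {a} {b} a≤k b≤l (m , m≤1 , w) =
      <⇒≱ shortcut (shortest-position-bound (ray l) (on-ray b≤l)
                     (take (walk (ray k)) (shell k + a) (on-ray a≤k) ++ w))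
      where
        reach : shell k + a + m ≤ suc (shell k + k)
        reach = ≤-trans (+-mono-≤ (+-monoʳ-≤ (shell k) a≤k) m≤1) (≤-reflexive (+-comm _ 1))

        shortcut : shell k + a + m < shell l + b
        shortcut = ≤-trans (s≤s reach) (≤-trans (shell-mono k<l) (m≤m+n (shell l) b))

bounded-eccentricity⇒paths : ExcludedMiddle 0ℓ → ∀ {G} → SupDiamInfinite G →
  (ecc : V G → ℕ) → (∀ v → EccentricityBound G v (ecc v)) → SeparatedIsometricPaths G
bounded-eccentricity⇒paths em {G} sup ecc bounded =
  separated-geodesics⇒paths P (λ k → k) geodesic (λ n → n , ≤-refl) apart
  where
    -- budget k bounds the eccentricities of the start vertices of all earlier paths.
    budget : ℕ → ℕ
    threshold : ℕ → ℕ

    threshold k = suc (k + (budget k + budget k))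

    budget zero = 0
    budget (suc k) = budget k + ecc (proj₁ (sup (threshold k)))

    start end : ℕ → V G
    start k = proj₁ (sup (threshold k))
    end k = proj₁ (proj₂ (sup (threshold k)))

    far : ∀ k → FarFrom G (start k) (threshold k) (end k)
    far k = proj₂ (proj₂ (sup (threshold k)))

    chord : ∀ k → ShortestWalk G (start k) (end k)
    chord k = shortestWalk em (proj₁ (far k))

    long : ∀ k → k ≤ length (chord k)
    long k = ≤-trans (≤-trans (m≤m+n k _) (n≤1+n _)) (proj₂ (far k) _ (_ , ≤-refl , walk (chord k)))

    P : ℕ → ℕ → V G
    P k = walk (chord k) !_

    geodesic : ∀ k → Geodesic G (P k) k
    geodesic k = segment (shortest⇒geodesic (chord k)) (long k)

    within-budget : ∀ {i k} → i < k → ecc (start i) ≤ budget k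
    within-budget {i} i<k =
      ≤-trans (m≤n+m _ (budget i)) (monotone-by-steps (λ n → m≤m+n (budget n) _) i<k)

    -- start k and end k are too far apart to both lie within reach of an earlier start vertex.
    disconnected : ∀ {i k m} → i < k → ¬ Walk G (start i) (start k) m
    disconnected {i} {k} i<k w
      with bounded (start i) (start k) (walk⇒connected w)
         | bounded (start i) (end k) (walk⇒connected (w ++ walk (chord k)))
    ... | m₁ , m₁≤e , w₁ | m₂ , m₂≤e , w₂ =
      <⇒≱ (s≤s (≤-trans (+-mono-≤ (within m₁≤e) (within m₂≤e)) (m≤n+m _ k)))
          (proj₂ (far k) _ (_ , ≤-refl , reverse w₁ ++ w₂))
      where
        within : ∀ {m} → m ≤ ecc (start i) → m ≤ budget k
        within m≤e = ≤-trans m≤e (within-budget i<k)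

    apart : ∀ {k l} → k < l → ∀ {a b} → a ≤ k → b ≤ l → ¬ Dist≤ G (P k a) (P l b) 1
    apart {k} {l} k<l {a} {b} a≤k b≤l (_ , _ , w) = disconnected k<l
      (take (walk (chord k)) a (≤-trans a≤k (long k)) ++ w ++
       reverse (take (walk (chord l)) b (≤-trans b≤l (long l))))

supDiamInfinite⇒paths : ExcludedMiddle 0ℓ → ∀ {G} → SupDiamInfinite G → SeparatedIsometricPaths G
supDiamInfinite⇒paths em {G} sup with em {Σ (V G) (InfiniteEccentricity G)}
... | yes (_ , infinite) = infinite-eccentricity⇒paths em infinite
... | no none = bounded-eccentricity⇒paths em sup (λ v → proj₁ (finite v)) (λ v → proj₂ (finite v))
  where
    finite : ∀ v → Σ ℕ (EccentricityBound G v)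
    finite v = finite-eccentricity em λ infinite → none (v , infinite)

paths⇒supDiamInfinite : ∀ {G} → SeparatedIsometricPaths G → SupDiamInfinite G
paths⇒supDiamInfinite (Vs , len , path , isometric , unbounded , _) n
  with unbounded n
... | k , n≤len
  with isometric-far (isometric k) (geodesic-ends-far (path⇒geodesic (path k)))
... | connected , far = _ , _ , connected , λ m d → ≤-trans n≤len (far m d)

lemma15 : ExcludedMiddle 0ℓ → (G : Graph) →
    SupDiamInfinite G ⇔
      (Σ (ℕ → V G → Set) λ Vs → Σ (ℕ → ℕ) λ len →
        ((k : ℕ) → IsPathOfLength (Induced G (Vs k)) (len k))
        × ((k : ℕ) → Isometric G (Vs k))
        × ((n : ℕ) → Σ ℕ λ k → n ≤ len k)
        × ((k l : ℕ) → k ≢ l → (v : V G) → Vs k v → Vs l v → ⊥)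
        × ((k l : ℕ) → k ≢ l → (u v : V G) → Vs k u → Vs l v → ¬ (_~_ G u v)))
lemma15 em G = mk⇔ (supDiamInfinite⇒paths em) paths⇒supDiamInfinite
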